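{- For every positive and abundant matrix $A\in\mathbb{Z}^{r\times m}$ and vector $\mathbf{b}\in\mathbb{Z}^r$ with $S(A,\mathbf{b})\neq\emptyset$, there exist constants $c_0 = c_0(A,\mathbf{b})>0$ and $n_0 = n_0(A,\mathbf{b})\in\mathbb{N}$ such that for every $n\geq n_0$, $$|S_0(A,\mathbf{b})\cap[n]^m| \geq c_0\, n^{m-\mathrm{rk}(A)}.$$
   Context: $S(A,\mathbf{b}) = \{\mathbf{x}\in\mathbb{Z}^m: A\mathbf{x}^T=\mathbf{b}^T\}$; $S_0(A,\mathbf{b})$ is the set of its elements with pairwise distinct entries. For $Q\subseteq[m]$, $A^Q$ is the submatrix of columns indexed by $Q$. $A$ is positive if $S(A,\mathbf{0})\cap\mathbb{N}^m\neq\emptyset$ (solutions with all entries positive integers exist); $A$ is abundant if $\mathrm{rk}(A)>0$ and $\mathrm{rk}(A^Q)=\mathrm{rk}(A)$ for all $Q\subseteq[m]$ with $|Q|\geq m-2$. -}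

module Defs where

open import Data.Nat as ℕ using (ℕ; zero; suc)
open import Data.Integer as ℤ using (ℤ; +_)
open import Data.Fin using (Fin; zero; suc)
open import Data.Fin.Subset using (Subset; _⊆_; _∉_; ∣_∣; ⊤)
open import Data.Fin.Properties using (all?)
import Data.Fin.Properties as FinP
import Data.Vec.Functional as VF
open import Data.List using (List; []; _∷_; map; concatMap; filter; length; upTo)
open import Data.Product using (Σ; _×_; ∃)
open import Relation.Binary.PropositionalEquality using (_≡_; _≢_)
open import Relation.Nullary using (Dec; ¬_)
open import Relation.Nullary.Decidable using (¬?; _→-dec_)
import Data.Integer.Properties as ℤP

Matrix : ℕ → ℕ → Set
Matrix r m = Fin r → Fin m → ℤ

Vector : ℕ → Set
Vector m = Fin m → ℤ

sumFin : ∀ {m} → (Fin m → ℤ) → ℤ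
sumFin {zero}  f = + 0
sumFin {suc m} f = f zero ℤ.+ sumFin (λ j → f (suc j))

_·_ : ∀ {r m} → Matrix r m → Vector m → Vector r
(A · x) i = sumFin (λ j → A i j ℤ.* x j)

IsSolution : ∀ {r m} → Matrix r m → Vector r → Vector m → Set
IsSolution A b x = ∀ i → (A · x) i ≡ b i

SolvableIn : ∀ {r m} → Matrix r m → Vector r → Set
SolvableIn {m = m} A b = Σ (Vector m) (IsSolution A b)

Distinct : ∀ {m} → Vector m → Set
Distinct x = ∀ i j → i ≢ j → x i ≢ x j

IsPositive : ∀ {r m} → Matrix r m → Set
IsPositive {m = m} A = Σ (Vector m) λ x → IsSolution A (λ _ → + 0) x × (∀ j → ℤ.+ 0 ℤ.< x j)

-- The columns of A indexed by P are linearly independent (over ℤ, equivalently over ℚ):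
-- every integer combination supported on P that vanishes is trivial.
IndependentCols : ∀ {r m} → Matrix r m → Subset m → Set
IndependentCols {m = m} A P =
  (c : Vector m) → (∀ j → j ∉ P → c j ≡ + 0) → (∀ i → (A · c) i ≡ + 0) → ∀ j → c j ≡ + 0

HasRankOn : ∀ {r m} → Matrix r m → Subset m → ℕ → Set
HasRankOn {m = m} A Q k =
  (Σ (Subset m) λ P → P ⊆ Q × ∣ P ∣ ≡ k × IndependentCols A P)
  × ((P : Subset m) → P ⊆ Q → IndependentCols A P → ∣ P ∣ ℕ.≤ k)

HasRank : ∀ {r m} → Matrix r m → ℕ → Set
HasRank A k = HasRankOn A ⊤ k

IsAbundant : ∀ {r m} → Matrix r m → Set
IsAbundant {m = m} A = Σ ℕ λ k → HasRank A k × 0 ℕ.< k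
  × ((Q : Subset m) → m ℕ.∸ 2 ℕ.≤ ∣ Q ∣ → HasRankOn A Q k)

-- all vectors in [n]^m, where [n] = {1,…,n}
box : (m n : ℕ) → List (Vector m)
box zero    n = (λ ()) ∷ []
box (suc m) n = concatMap (λ v → map (λ a → (+ suc a) VF.∷ v) (upTo n)) (box m n)

isSolution? : ∀ {r m} (A : Matrix r m) (b : Vector r) (x : Vector m) → Dec (IsSolution A b x)
isSolution? A b x = all? (λ i → (A · x) i ℤP.≟ b i)

distinct? : ∀ {m} (x : Vector m) → Dec (Distinct x)
distinct? x = all? λ i → all? λ j → ¬? (i FinP.≟ j) →-dec ¬? (x i ℤP.≟ x j)

countS0 : ∀ {r m} → Matrix r m → Vector r → ℕ → ℕ
countS0 {m = m} A b n =
  length (filter (λ x → distinct? x) (filter (λ x → isSolution? A b x) (box m n)))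

-- Fix a maximal independent set P of columns, |P| = k, and enumerate its complement as f₀, …, f_d, so that
-- d + 1 = m − k. Together with a positive kernel vector p, each column f_l (l ≥ 1) yields a kernel vector
-- supported on P ∪ {f_l} and nonzero at f_l. These m − k directions are triangular at the coordinates f_l,
-- and abundance (deleting two columns keeps the rank) forces one of them to separate any two coordinates.
-- For a scale T take x₀ + Σ_l y_l·dir_l with y_l ∈ [w_l·T, (w_l + 1)·T) and rapidly increasing weights w_l:
-- every such point solves A x = b, in each entry and each difference of entries the first nonzero term
-- dominates, so the entries are positive and pairwise distinct, and triangularity makes the points
-- pairwise different. They lie in [E·T]^m, so taking T = ⌊n / E⌋ gives ≳ (n / 2E)^(m − k) elements.

module Submission where

open import Defs

module Construction where

  import Algebra.Properties.Semiring.Sum as SemiringSum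
  open import Data.Nat as ℕ using (ℕ; zero; suc; z≤n; s≤s; _^_)
  import Data.Nat.Properties as ℕP
  import Data.Nat.DivMod as DM
  import Data.Nat.Tactic.RingSolver as ℕSolver
  open import Data.Integer as ℤ using (ℤ; +_; -[1+_]; 0ℤ; 1ℤ; -1ℤ; -_; _+_; _*_; _-_)
  import Data.Integer.Properties as ℤP
  open import Algebra.Properties.AbelianGroup ℤP.+-0-abelianGroup using (∙-cancelˡ)
  open import Data.Integer.Tactic.RingSolver using (solve-∀)
  open import Data.Fin using (Fin; zero; suc; toℕ; combine; finToFun; funToFin)
  import Data.Fin.Properties as FinP
  open import Data.Fin.Subset using (Subset; _∈_; _∉_; ∣_∣; ⁅_⁆; _∪_; _⊂_; ∁; inside; outside) renaming (_-_ to _∖_)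
  open import Data.Fin.Subset.Properties
    using (_∈?_; x∈p∧x≢y⇒x∈p-y; p─q⊆p; ⊆-max; p⊆p∪q; q⊆p∪q; x∈p∪q⁻; x∈p∪q⁺; x∈⁅x⁆; x∈⁅y⁆⇒x≡y; ∣⁅x⁆∣≡1;
           p⊂q⇒∣p∣<∣q∣; x∈p⇒x∉∁p; x∈∁p⇒x∉p; x∉p⇒x∈∁p; ∣∁p∣≡n∸∣p∣; ∣p∣≤n)
  open import Data.Vec using ([]; _∷_; here; there)
  open import Data.Product using (Σ; _×_; _,_; proj₁; proj₂)
  open import Data.Sum using (_⊎_; inj₁; inj₂; [_,_]′)
  open import Data.Empty using (⊥; ⊥-elim)
  open import Data.List using (List; []; _∷_; allFin; map; filter; length; lookup; upTo)
  import Data.List.Relation.Unary.Any as Any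
  import Data.List.Relation.Unary.Any.Properties as AnyP
  import Data.List.Membership.Setoid.Properties as SetoidMembershipP
  open import Data.List.Membership.Propositional using () renaming (_∈_ to _∈ₗ_)
  open import Data.List.Membership.Propositional.Properties using (∈-allFin; ∈-upTo⁺)
  import Data.Vec.Functional as VF
  open import Function using (_∘_; id)
  open import Relation.Nullary using (yes; no)
  open import Relation.Binary.Definitions using (tri<; tri≈; tri>)
  open import Relation.Nullary.Decidable using (_×-dec_; ¬?; decidable-stable)
  open import Relation.Binary.PropositionalEquality

  -- Finite sums and dot products

  module ℤΣ = SemiringSum ℤP.+-*-semiring
  module ℕΣ = SemiringSum ℕP.+-*-semiring
  open ℤΣ using (sum)

  sumFin≡sum : ∀ {m} (f : Fin m → ℤ) → sumFin f ≡ sum f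
  sumFin≡sum {zero}  f = refl
  sumFin≡sum {suc m} f = cong (λ s → f zero + s) (sumFin≡sum (f ∘ suc))

  sum-zero : ∀ {n} {f : Fin n → ℤ} → (∀ j → f j ≡ 0ℤ) → sum f ≡ 0ℤ
  sum-zero {n} f≗0 = trans (ℤΣ.sum-cong-≗ f≗0) (ℤΣ.sum-replicate-zero n)

  sum-single : ∀ {n} (f : Fin n → ℤ) j₀ → (∀ j → j ≢ j₀ → f j ≡ 0ℤ) → sum f ≡ f j₀
  sum-single {suc n} f zero off =
    trans (cong (λ s → f zero + s) (sum-zero λ j → off (suc j) λ ())) (ℤP.+-identityʳ (f zero))
  sum-single {suc n} f (suc j₀) off =
    trans (cong (_+ sum (f ∘ suc)) (off zero λ ()))
          (trans (ℤP.+-identityˡ _) (sum-single (f ∘ suc) j₀ λ j j≢j₀ → off (suc j) (j≢j₀ ∘ FinP.suc-injective)))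

  -- (A · u) i is definitionally A i ⊙ u.
  infix 7 _⊙_
  _⊙_ : ∀ {m} → Vector m → Vector m → ℤ
  a ⊙ u = sumFin (λ j → a j * u j)

  lincomb : ∀ {m} → ℤ → Vector m → ℤ → Vector m → Vector m
  lincomb α u β v j = α * u j + β * v j

  ⊙-lincombʳ : ∀ {m} (a u v : Vector m) α β → a ⊙ lincomb α u β v ≡ α * (a ⊙ u) + β * (a ⊙ v)
  ⊙-lincombʳ a u v α β = begin
    a ⊙ lincomb α u β v
      ≡⟨ sumFin≡sum (λ j → a j * (α * u j + β * v j)) ⟩
    sum (λ j → a j * (α * u j + β * v j))
      ≡⟨ ℤΣ.sum-cong-≗ (λ j → distrib α β (a j) (u j) (v j)) ⟩
    sum (λ j → α * (a j * u j) + β * (a j * v j))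
      ≡⟨ ℤΣ.∑-distrib-+ (λ j → α * (a j * u j)) (λ j → β * (a j * v j)) ⟩
    sum (λ j → α * (a j * u j)) + sum (λ j → β * (a j * v j))
      ≡⟨ sym (cong₂ _+_ (ℤΣ.*-distribˡ-sum α (λ j → a j * u j)) (ℤΣ.*-distribˡ-sum β (λ j → a j * v j))) ⟩
    α * sum (λ j → a j * u j) + β * sum (λ j → a j * v j)
      ≡⟨ sym (cong₂ (λ x y → α * x + β * y) (sumFin≡sum (λ j → a j * u j)) (sumFin≡sum (λ j → a j * v j))) ⟩
    α * (a ⊙ u) + β * (a ⊙ v) ∎
    where
    open ≡-Reasoning
    distrib : ∀ α β a u v → a * (α * u + β * v) ≡ α * (a * u) + β * (a * v)
    distrib = solve-∀

  ⊙-comm : ∀ {m} (a u : Vector m) → a ⊙ u ≡ u ⊙ a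
  ⊙-comm a u = trans (sumFin≡sum (λ j → a j * u j))
    (trans (ℤΣ.sum-cong-≗ λ j → ℤP.*-comm (a j) (u j)) (sym (sumFin≡sum (λ j → u j * a j))))

  ⊙-lincombˡ : ∀ {m} (a b u : Vector m) α β → lincomb α a β b ⊙ u ≡ α * (a ⊙ u) + β * (b ⊙ u)
  ⊙-lincombˡ a b u α β =
    trans (⊙-comm _ u) (trans (⊙-lincombʳ u a b α β) (cong₂ (λ x y → α * x + β * y) (⊙-comm u a) (⊙-comm u b)))

  basis : ∀ {m} → Fin m → Vector m
  basis zero    zero    = 1ℤ
  basis zero    (suc _) = 0ℤ
  basis (suc _) zero    = 0ℤ
  basis (suc i) (suc j) = basis i j

  basis-diag : ∀ {m} (i : Fin m) → basis i i ≡ 1ℤ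
  basis-diag zero    = refl
  basis-diag (suc i) = basis-diag i

  basis-offdiag : ∀ {m} {i j : Fin m} → i ≢ j → basis i j ≡ 0ℤ
  basis-offdiag {i = zero}  {zero}  i≢j = ⊥-elim (i≢j refl)
  basis-offdiag {i = zero}  {suc j} i≢j = refl
  basis-offdiag {i = suc i} {zero}  i≢j = refl
  basis-offdiag {i = suc i} {suc j} i≢j = basis-offdiag (i≢j ∘ cong suc)

  ⊙-basis : ∀ {m} (a : Vector m) i → a ⊙ basis i ≡ a i
  ⊙-basis a i = begin
    a ⊙ basis i                  ≡⟨ sumFin≡sum (λ j → a j * basis i j) ⟩
    sum (λ j → a j * basis i j)  ≡⟨ sum-single (λ j → a j * basis i j) i (λ j j≢i → trans (cong (a j *_) (basis-offdiag (j≢i ∘ sym))) (ℤP.*-zeroʳ (a j))) ⟩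
    a i * basis i i              ≡⟨ trans (cong (a i *_) (basis-diag i)) (ℤP.*-identityʳ (a i)) ⟩
    a i                          ∎
    where open ≡-Reasoning

  ⊙-zeroʳ : ∀ {m} (a : Vector m) {u : Vector m} → (∀ j → u j ≡ 0ℤ) → a ⊙ u ≡ 0ℤ
  ⊙-zeroʳ a {u} u≗0 =
    trans (sumFin≡sum (λ j → a j * u j)) (sum-zero λ j → trans (cong (a j *_) (u≗0 j)) (ℤP.*-zeroʳ (a j)))

  ⊙-+ʳ : ∀ {m} (a u w : Vector m) → a ⊙ (λ t → u t + w t) ≡ a ⊙ u + a ⊙ w
  ⊙-+ʳ a u w = begin
    a ⊙ (λ t → u t + w t)                         ≡⟨ sumFin≡sum (λ t → a t * (u t + w t)) ⟩
    sum (λ t → a t * (u t + w t))                 ≡⟨ ℤΣ.sum-cong-≗ (λ t → ℤP.*-distribˡ-+ (a t) (u t) (w t)) ⟩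
    sum (λ t → a t * u t + a t * w t)             ≡⟨ ℤΣ.∑-distrib-+ (λ t → a t * u t) (λ t → a t * w t) ⟩
    sum (λ t → a t * u t) + sum (λ t → a t * w t) ≡⟨ sym (cong₂ _+_ (sumFin≡sum (λ t → a t * u t)) (sumFin≡sum (λ t → a t * w t))) ⟩
    a ⊙ u + a ⊙ w                                 ∎
    where open ≡-Reasoning

  ⊙-sum : ∀ {m n} (a : Vector m) (v : Fin n → Vector m) (y : Fin n → ℤ) →
    a ⊙ (λ t → sum (λ l → v l t * y l)) ≡ sum (λ l → (a ⊙ v l) * y l)
  ⊙-sum a v y = begin
    a ⊙ (λ t → sum (λ l → v l t * y l))           ≡⟨ sumFin≡sum (λ t → a t * sum (λ l → v l t * y l)) ⟩
    sum (λ t → a t * sum (λ l → v l t * y l))     ≡⟨ ℤΣ.sum-cong-≗ (λ t → ℤΣ.*-distribˡ-sum (a t) (λ l → v l t * y l)) ⟩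
    sum (λ t → sum (λ l → a t * (v l t * y l)))   ≡⟨ ℤΣ.∑-comm (λ t l → a t * (v l t * y l)) ⟩
    sum (λ l → sum (λ t → a t * (v l t * y l)))   ≡⟨ ℤΣ.sum-cong-≗ (λ l → ℤΣ.sum-cong-≗ (λ t → sym (ℤP.*-assoc (a t) (v l t) (y l)))) ⟩
    sum (λ l → sum (λ t → a t * v l t * y l))     ≡⟨ ℤΣ.sum-cong-≗ (λ l → sym (ℤΣ.*-distribʳ-sum (y l) (λ t → a t * v l t))) ⟩
    sum (λ l → sum (λ t → a t * v l t) * y l)     ≡⟨ ℤΣ.sum-cong-≗ (λ l → cong (_* y l) (sym (sumFin≡sum (λ t → a t * v l t)))) ⟩
    sum (λ l → (a ⊙ v l) * y l)                   ∎
    where open ≡-Reasoning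

  *-≢0 : ∀ {x y} → x ≢ 0ℤ → y ≢ 0ℤ → x * y ≢ 0ℤ
  *-≢0 {x} x≢0 y≢0 xy≡0 with ℤP.i*j≡0⇒i≡0∨j≡0 x xy≡0
  ... | inj₁ x≡0 = x≢0 x≡0
  ... | inj₂ y≡0 = y≢0 y≡0

  x∉p∖x : ∀ {m} (p : Subset m) (x : Fin m) → x ∉ p ∖ x
  x∉p∖x (s ∷ p) (suc x) (there x∈p∖x) = x∉p∖x p x x∈p∖x

  -- Gaussian elimination

  Ker : ∀ {r m} → Matrix r m → Vector m → Set
  Ker A u = ∀ i → (A · u) i ≡ 0ℤ

  SupportedOn : ∀ {m} → Subset m → Vector m → Set
  SupportedOn S u = ∀ j → j ∉ S → u j ≡ 0ℤ

  KernelVectorOn : ∀ {r m} → Matrix r m → Subset m → Set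
  KernelVectorOn {m = m} A S = Σ (Vector m) λ c → SupportedOn S c × Ker A c × Σ (Fin m) λ j → c j ≢ 0ℤ

  Ker-lincomb : ∀ {r m} (A : Matrix r m) {u v : Vector m} α β → Ker A u → Ker A v → Ker A (lincomb α u β v)
  Ker-lincomb A {u} {v} α β Au≡0 Av≡0 i =
    trans (⊙-lincombʳ (A i) u v α β) (trans (cong₂ (λ x y → α * x + β * y) (Au≡0 i) (Av≡0 i)) (zeros α β))
    where
    zeros : ∀ α β → α * 0ℤ + β * 0ℤ ≡ 0ℤ
    zeros = solve-∀

  module RowReduction {r m} (A : Matrix (suc r) m) (S : Subset m) (j₀ : Fin m) (j₀∈S : j₀ ∈ S)
                      (pivot≢0 : A zero j₀ ≢ 0ℤ) where

    a : Vector m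
    a = A zero

    reduced : Matrix r m
    reduced i = lincomb (a j₀) (A (suc i)) (- A (suc i) j₀) a

    drop-pivot : Vector m → Vector m
    drop-pivot c = lincomb 1ℤ c (- c j₀) (basis j₀)

    drop-pivot-supported : ∀ {c} → SupportedOn S c → SupportedOn (S ∖ j₀) (drop-pivot c)
    drop-pivot-supported {c} c-supp j j∉S∖j₀ with j FinP.≟ j₀
    ... | yes refl = trans (cong (λ e → 1ℤ * c j₀ + (- c j₀) * e) (basis-diag j₀)) (cancel (c j₀))
      where
      cancel : ∀ x → 1ℤ * x + (- x) * 1ℤ ≡ 0ℤ
      cancel = solve-∀
    ... | no j≢j₀ with j ∈? S
    ...   | yes j∈S = ⊥-elim (j∉S∖j₀ (x∈p∧x≢y⇒x∈p-y j∈S j≢j₀))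
    ...   | no j∉S  = trans (cong₂ (λ x e → 1ℤ * x + (- c j₀) * e) (c-supp j j∉S) (basis-offdiag (j≢j₀ ∘ sym)))
                            (zeros (c j₀))
      where
      zeros : ∀ x → 1ℤ * 0ℤ + (- x) * 0ℤ ≡ 0ℤ
      zeros = solve-∀

    ⊙-drop-pivot : ∀ {c} (b : Vector m) → b ⊙ c ≡ 0ℤ → b ⊙ drop-pivot c ≡ - (c j₀ * b j₀)
    ⊙-drop-pivot {c} b bc≡0 = begin
      b ⊙ drop-pivot c                        ≡⟨ ⊙-lincombʳ b c (basis j₀) 1ℤ (- c j₀) ⟩
      1ℤ * (b ⊙ c) + (- c j₀) * (b ⊙ basis j₀) ≡⟨ cong₂ (λ x y → 1ℤ * x + (- c j₀) * y) bc≡0 (⊙-basis b j₀) ⟩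
      1ℤ * 0ℤ + (- c j₀) * b j₀                ≡⟨ negate (c j₀) (b j₀) ⟩
      - (c j₀ * b j₀)                          ∎
      where
      open ≡-Reasoning
      negate : ∀ x y → 1ℤ * 0ℤ + (- x) * y ≡ - (x * y)
      negate = solve-∀

    drop-pivot-ker : ∀ {c} → Ker A c → Ker reduced (drop-pivot c)
    drop-pivot-ker {c} c-ker i = begin
      reduced i ⊙ drop-pivot c
        ≡⟨ ⊙-lincombˡ (A (suc i)) a (drop-pivot c) (a j₀) (- A (suc i) j₀) ⟩
      a j₀ * (A (suc i) ⊙ drop-pivot c) + (- A (suc i) j₀) * (a ⊙ drop-pivot c)
        ≡⟨ cong₂ (λ x y → a j₀ * x + (- A (suc i) j₀) * y) (⊙-drop-pivot (A (suc i)) (c-ker (suc i))) (⊙-drop-pivot a (c-ker zero)) ⟩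
      a j₀ * - (c j₀ * A (suc i) j₀) + (- A (suc i) j₀) * - (c j₀ * a j₀)
        ≡⟨ cancel (a j₀) (A (suc i) j₀) (c j₀) ⟩
      0ℤ ∎
      where
      open ≡-Reasoning
      cancel : ∀ x y z → x * - (z * y) + (- y) * - (z * x) ≡ 0ℤ
      cancel = solve-∀

    independent-lift : IndependentCols reduced (S ∖ j₀) → IndependentCols A S
    independent-lift reduced-ind c c-supp c-ker j = begin
      c j                                   ≡⟨ split (c j) (c j₀) (basis j₀ j) ⟩
      drop-pivot c j + c j₀ * basis j₀ j    ≡⟨ cong₂ (λ x y → x + y * basis j₀ j) (c′≡0 j) cj₀≡0 ⟩
      0ℤ + 0ℤ * basis j₀ j                  ≡⟨ ℤP.*-zeroˡ (basis j₀ j) ⟩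
      0ℤ                                    ∎
      where
      open ≡-Reasoning
      split : ∀ x y z → x ≡ (1ℤ * x + (- y) * z) + y * z
      split = solve-∀
      c′≡0 : ∀ j → drop-pivot c j ≡ 0ℤ
      c′≡0 = reduced-ind (drop-pivot c) (drop-pivot-supported c-supp) (drop-pivot-ker c-ker)
      cj₀≡0 : c j₀ ≡ 0ℤ
      cj₀≡0 = [ id , ⊥-elim ∘ pivot≢0 ]′ (ℤP.i*j≡0⇒i≡0∨j≡0 (c j₀)
                (ℤP.neg-injective {c j₀ * a j₀} {0ℤ} (trans (sym (⊙-drop-pivot a (c-ker zero))) (⊙-zeroʳ a c′≡0))))

    kernelVector-lift : KernelVectorOn reduced (S ∖ j₀) → KernelVectorOn A S
    kernelVector-lift (c′ , c′-supp , c′-ker , j₁ , c′j₁≢0) = c , c-supp , c-ker , j₁ , cj₁≢0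
      where
      c : Vector m
      c = lincomb (a j₀) c′ (- (a ⊙ c′)) (basis j₀)
      c-eval : ∀ (b : Vector m) → b ⊙ c ≡ a j₀ * (b ⊙ c′) + (- (a ⊙ c′)) * b j₀
      c-eval b = trans (⊙-lincombʳ b c′ (basis j₀) (a j₀) (- (a ⊙ c′))) (cong (λ y → a j₀ * (b ⊙ c′) + (- (a ⊙ c′)) * y) (⊙-basis b j₀))
      c-supp : SupportedOn S c
      c-supp j j∉S = trans (cong₂ (λ x e → a j₀ * x + (- (a ⊙ c′)) * e)
                                  (c′-supp j (j∉S ∘ p─q⊆p S ⁅ j₀ ⁆)) (basis-offdiag λ j₀≡j → j∉S (subst (_∈ S) j₀≡j j₀∈S)))
                           (zeros (a j₀) (a ⊙ c′))
        where
        zeros : ∀ x y → x * 0ℤ + (- y) * 0ℤ ≡ 0ℤ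
        zeros = solve-∀
      c-ker : Ker A c
      c-ker zero    = trans (c-eval a) (cancel (a j₀) (a ⊙ c′))
        where
        cancel : ∀ x y → x * y + (- y) * x ≡ 0ℤ
        cancel = solve-∀
      c-ker (suc i) = trans (c-eval (A (suc i)))
                            (trans (swap (a j₀) (A (suc i) ⊙ c′) (a ⊙ c′) (A (suc i) j₀))
                                   (trans (sym (⊙-lincombˡ (A (suc i)) a c′ (a j₀) (- A (suc i) j₀))) (c′-ker i)))
        where
        swap : ∀ x y z w → x * y + (- z) * w ≡ x * y + (- w) * z
        swap = solve-∀
      j₀≢j₁ : j₀ ≢ j₁
      j₀≢j₁ refl = c′j₁≢0 (c′-supp j₀ (x∉p∖x S j₀))
      cj₁≢0 : c j₁ ≢ 0ℤ
      cj₁≢0 cj₁≡0 = *-≢0 pivot≢0 c′j₁≢0 (begin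
        a j₀ * c′ j₁                                          ≡⟨ sym (ℤP.+-identityʳ _) ⟩
        a j₀ * c′ j₁ + 0ℤ                                     ≡⟨ cong (λ z → a j₀ * c′ j₁ + z) (sym (trans (cong ((- (a ⊙ c′)) *_) (basis-offdiag j₀≢j₁)) (ℤP.*-zeroʳ (- (a ⊙ c′))))) ⟩
        a j₀ * c′ j₁ + (- (a ⊙ c′)) * basis j₀ j₁             ≡⟨ cj₁≡0 ⟩
        0ℤ                                                    ∎)
        where open ≡-Reasoning

  independent⊎kernelVector : ∀ {r m} (A : Matrix r m) (S : Subset m) → IndependentCols A S ⊎ KernelVectorOn A S
  independent⊎kernelVector {zero} A S with FinP.any? (_∈? S)
  ... | yes (j , j∈S) = inj₂ (basis j , (λ j′ j′∉S → basis-offdiag λ j≡j′ → j′∉S (subst (_∈ S) j≡j′ j∈S))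
                             , (λ ()) , j , λ e → 1≢0 (trans (sym (basis-diag j)) e))
    where
    1≢0 : 1ℤ ≢ 0ℤ
    1≢0 ()
  ... | no S-empty = inj₁ (λ c c-supp _ j → c-supp j λ j∈S → S-empty (j , j∈S))
  independent⊎kernelVector {suc r} A S with FinP.any? (λ j → (j ∈? S) ×-dec ¬? (A zero j ℤP.≟ 0ℤ))
  ... | yes (j₀ , j₀∈S , pivot≢0) with independent⊎kernelVector reduced (S ∖ j₀)
    where open RowReduction A S j₀ j₀∈S pivot≢0
  ...   | inj₁ ind = inj₁ (RowReduction.independent-lift A S j₀ j₀∈S pivot≢0 ind)
  ...   | inj₂ kv  = inj₂ (RowReduction.kernelVector-lift A S j₀ j₀∈S pivot≢0 kv)
  independent⊎kernelVector {suc r} A S | no no-pivot with independent⊎kernelVector (A ∘ suc) S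
  ... | inj₁ ind = inj₁ λ c c-supp c-ker → ind c c-supp (c-ker ∘ suc)
  ... | inj₂ (c , c-supp , c-ker , j , cj≢0) = inj₂ (c , c-supp , c-ker′ , j , cj≢0)
    where
    vanishes : ∀ j → A zero j * c j ≡ 0ℤ
    vanishes j with j ∈? S | A zero j ℤP.≟ 0ℤ
    ... | no j∉S  | _           = trans (cong (A zero j *_) (c-supp j j∉S)) (ℤP.*-zeroʳ (A zero j))
    ... | yes _   | yes Aj≡0    = trans (cong (_* c j) Aj≡0) (ℤP.*-zeroˡ (c j))
    ... | yes j∈S | no Aj≢0     = ⊥-elim (no-pivot (j , j∈S , Aj≢0))
    c-ker′ : Ker A c
    c-ker′ zero    = trans (sumFin≡sum (λ j → A zero j * c j)) (sum-zero vanishes)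
    c-ker′ (suc i) = c-ker i

  -- Kernel vectors from rank and abundance

  ∣p∪q∣≤∣p∣+∣q∣ : ∀ {m} (p q : Subset m) → ∣ p ∪ q ∣ ℕ.≤ ∣ p ∣ ℕ.+ ∣ q ∣
  ∣p∪q∣≤∣p∣+∣q∣ []            []            = z≤n
  ∣p∪q∣≤∣p∣+∣q∣ (inside  ∷ p) (inside  ∷ q) = s≤s (ℕP.≤-trans (∣p∪q∣≤∣p∣+∣q∣ p q) (ℕP.+-monoʳ-≤ ∣ p ∣ (ℕP.n≤1+n ∣ q ∣)))
  ∣p∪q∣≤∣p∣+∣q∣ (inside  ∷ p) (outside ∷ q) = s≤s (∣p∪q∣≤∣p∣+∣q∣ p q)
  ∣p∪q∣≤∣p∣+∣q∣ (outside ∷ p) (inside  ∷ q) = ℕP.≤-trans (s≤s (∣p∪q∣≤∣p∣+∣q∣ p q)) (ℕP.≤-reflexive (sym (ℕP.+-suc ∣ p ∣ ∣ q ∣)))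
  ∣p∪q∣≤∣p∣+∣q∣ (outside ∷ p) (outside ∷ q) = ∣p∪q∣≤∣p∣+∣q∣ p q

  RankAtMost : ∀ {r m} → Matrix r m → ℕ → Set
  RankAtMost {m = m} A k = (P : Subset m) → IndependentCols A P → ∣ P ∣ ℕ.≤ k

  HasRank⇒RankAtMost : ∀ {r m} (A : Matrix r m) {k} → HasRank A k → RankAtMost A k
  HasRank⇒RankAtMost A (_ , maximal) P = maximal P (⊆-max P)

  -- By maximality P ∪ {f} is dependent, and a dependency avoiding f would contradict the independence of P.
  kernelVector-through : ∀ {r m} (A : Matrix r m) {k} {P : Subset m} → RankAtMost A k → k ℕ.≤ ∣ P ∣ →
    IndependentCols A P → ∀ {f} → f ∉ P → Σ (Vector m) λ v → Ker A v × SupportedOn (P ∪ ⁅ f ⁆) v × v f ≢ 0ℤ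
  kernelVector-through A {k} {P} rank≤k k≤∣P∣ P-ind {f} f∉P with independent⊎kernelVector A (P ∪ ⁅ f ⁆)
  ... | inj₁ P∪f-ind =
    ⊥-elim (ℕP.<-irrefl refl (ℕP.<-≤-trans (p⊂q⇒∣p∣<∣q∣ P⊂P∪f) (ℕP.≤-trans (rank≤k _ P∪f-ind) k≤∣P∣)))
    where
    P⊂P∪f : P ⊂ P ∪ ⁅ f ⁆
    P⊂P∪f = p⊆p∪q ⁅ f ⁆ , f , q⊆p∪q P ⁅ f ⁆ (x∈⁅x⁆ f) , f∉P
  ... | inj₂ (v , v-supp , v-ker , j , vj≢0) = v , v-ker , v-supp , vf≢0
    where
    vf≢0 : v f ≢ 0ℤ
    vf≢0 vf≡0 = vj≢0 (P-ind v v-suppP v-ker j)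
      where
      v-suppP : SupportedOn P v
      v-suppP j′ j′∉P with j′ FinP.≟ f
      ... | yes refl = vf≡0
      ... | no j′≢f  = v-supp j′ ([ j′∉P , j′≢f ∘ x∈⁅y⁆⇒x≡y f ]′ ∘ x∈p∪q⁻ P ⁅ f ⁆)

  separatingKernelVector : ∀ {r m} (A : Matrix r m) → IsAbundant A → ∀ {i j} → i ≢ j →
    Σ (Vector m) λ w → Ker A w × w i ≢ w j
  separatingKernelVector {m = m} A (k , rank-k , _ , abundant) {i} {j} i≢j
    with abundant (∁ (⁅ i ⁆ ∪ ⁅ j ⁆)) large
    where
    large : m ℕ.∸ 2 ℕ.≤ ∣ ∁ (⁅ i ⁆ ∪ ⁅ j ⁆) ∣
    large = subst (m ℕ.∸ 2 ℕ.≤_) (sym (∣∁p∣≡n∸∣p∣ (⁅ i ⁆ ∪ ⁅ j ⁆)))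
              (ℕP.∸-monoʳ-≤ m (subst₂ (λ a b → ∣ ⁅ i ⁆ ∪ ⁅ j ⁆ ∣ ℕ.≤ a ℕ.+ b) (∣⁅x⁆∣≡1 i) (∣⁅x⁆∣≡1 j) (∣p∪q∣≤∣p∣+∣q∣ ⁅ i ⁆ ⁅ j ⁆)))
  ... | (P , P⊆Q , ∣P∣≡k , P-ind) , _
    with kernelVector-through A (HasRank⇒RankAtMost A rank-k) (ℕP.≤-reflexive (sym ∣P∣≡k)) P-ind
                              (x∈p⇒x∉∁p (x∈p∪q⁺ (inj₁ (x∈⁅x⁆ i))) ∘ P⊆Q)
  ... | w , w-ker , w-supp , wi≢0 = w , w-ker , λ wi≡wj → wi≢0 (trans wi≡wj (w-supp j j∉P∪i))
    where
    j∉P∪i : j ∉ P ∪ ⁅ i ⁆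
    j∉P∪i = [ x∈p⇒x∉∁p (x∈p∪q⁺ (inj₂ (x∈⁅x⁆ j))) ∘ P⊆Q , i≢j ∘ sym ∘ x∈⁅y⁆⇒x≡y i ]′ ∘ x∈p∪q⁻ P ⁅ i ⁆

  -- A triangular frame of kernel directions

  enumerate : ∀ {m} (Q : Subset m) → Fin ∣ Q ∣ → Fin m
  enumerate (inside  ∷ Q) zero    = zero
  enumerate (inside  ∷ Q) (suc l) = suc (enumerate Q l)
  enumerate (outside ∷ Q) l       = suc (enumerate Q l)

  enumerate-∈ : ∀ {m} (Q : Subset m) l → enumerate Q l ∈ Q
  enumerate-∈ (inside  ∷ Q) zero    = here
  enumerate-∈ (inside  ∷ Q) (suc l) = there (enumerate-∈ Q l)
  enumerate-∈ (outside ∷ Q) l       = there (enumerate-∈ Q l)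

  enumerate-injective : ∀ {m} (Q : Subset m) {l l′} → enumerate Q l ≡ enumerate Q l′ → l ≡ l′
  enumerate-injective (inside  ∷ Q) {zero}  {zero}   _ = refl
  enumerate-injective (inside  ∷ Q) {suc l} {suc l′} e = cong suc (enumerate-injective Q (FinP.suc-injective e))
  enumerate-injective (outside ∷ Q)                  e = enumerate-injective Q (FinP.suc-injective e)

  enumerate-surjective : ∀ {m} (Q : Subset m) {j} → j ∈ Q → Σ (Fin ∣ Q ∣) λ l → enumerate Q l ≡ j
  enumerate-surjective (inside  ∷ Q) here         = zero , refl
  enumerate-surjective (inside  ∷ Q) (there j∈Q)  with enumerate-surjective Q j∈Q
  ... | l , refl = suc l , refl
  enumerate-surjective (outside ∷ Q) (there j∈Q) with enumerate-surjective Q j∈Q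
  ... | l , refl = l , refl

  record Enumeration {m} (Q : Subset m) (n : ℕ) : Set where
    field
      at            : Fin n → Fin m
      at-∈          : ∀ l → at l ∈ Q
      at-injective  : ∀ {l l′} → at l ≡ at l′ → l ≡ l′
      at-surjective : ∀ {j} → j ∈ Q → Σ (Fin n) λ l → at l ≡ j

  enumeration : ∀ {m} (Q : Subset m) {n} → ∣ Q ∣ ≡ n → Enumeration Q n
  enumeration Q refl = record
    { at = enumerate Q ; at-∈ = enumerate-∈ Q ; at-injective = enumerate-injective Q ; at-surjective = enumerate-surjective Q }

  clear : ∀ {m} → Vector m → Vector m → Fin m → Vector m
  clear u v f = lincomb (v f) u (- u f) v

  clear-at : ∀ {m} (u v : Vector m) f → clear u v f f ≡ 0ℤ
  clear-at u v f = cancel (u f) (v f)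
    where
    cancel : ∀ x y → y * x + (- x) * y ≡ 0ℤ
    cancel = solve-∀

  clear-zero : ∀ {m} (u v : Vector m) f {g} → u g ≡ 0ℤ → v g ≡ 0ℤ → clear u v f g ≡ 0ℤ
  clear-zero u v f ug≡0 vg≡0 = trans (cong₂ (λ x y → v f * x + (- u f) * y) ug≡0 vg≡0) (zeros (v f) (u f))
    where
    zeros : ∀ x y → x * 0ℤ + (- y) * 0ℤ ≡ 0ℤ
    zeros = solve-∀

  clear-separates : ∀ {m} (u v : Vector m) f {s t} → v f ≢ 0ℤ → v s ≡ v t → u s ≢ u t → clear u v f s ≢ clear u v f t
  clear-separates u v f {s} {t} vf≢0 vs≡vt us≢ut clear≡ = us≢ut (ℤP.i-j≡0⇒i≡j (u s) (u t) us-ut≡0)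
    where
    difference : ∀ α x y β z → α * (x - y) ≡ (α * x + β * z) - (α * y + β * z)
    difference = solve-∀
    scaled≡0 : v f * (u s - u t) ≡ 0ℤ
    scaled≡0 = begin
      v f * (u s - u t)                                              ≡⟨ difference (v f) (u s) (u t) (- u f) (v s) ⟩
      (v f * u s + (- u f) * v s) - (v f * u t + (- u f) * v s)      ≡⟨ cong (λ z → clear u v f s - (v f * u t + (- u f) * z)) vs≡vt ⟩
      clear u v f s - clear u v f t                                  ≡⟨ cong (_- clear u v f t) clear≡ ⟩
      clear u v f t - clear u v f t                                  ≡⟨ ℤP.+-inverseʳ (clear u v f t) ⟩
      0ℤ                                                             ∎
      where open ≡-Reasoning
    us-ut≡0 : u s - u t ≡ 0ℤ
    us-ut≡0 = [ ⊥-elim ∘ vf≢0 , id ]′ (ℤP.i*j≡0⇒i≡0∨j≡0 (v f) scaled≡0)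

  record KernelFrame {r m} (A : Matrix r m) (d : ℕ) : Set where
    field
      pivot          : Fin (suc d) → Fin m
      dir            : Fin (suc d) → Vector m
      dir-ker        : ∀ l → Ker A (dir l)
      dir-positive   : ∀ t → 0ℤ ℤ.< dir zero t
      dir-triangular : ∀ l {l′} → l′ ≢ suc l → dir (suc l) (pivot l′) ≡ 0ℤ
      dir-diagonal   : ∀ l → dir (suc l) (pivot (suc l)) ≢ 0ℤ
      dir-separates  : ∀ {s t} → s ≢ t → Σ (Fin (suc d)) λ l → dir l s ≢ dir l t

  0<⇒≢0 : ∀ {z} → 0ℤ ℤ.< z → z ≢ 0ℤ
  0<⇒≢0 (ℤ.+<+ ()) refl

  module FrameConstruction {r m} (A : Matrix r m) {k} (abundant : IsAbundant A) (rank≤k : RankAtMost A k)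
    {P : Subset m} (∣P∣≡k : ∣ P ∣ ≡ k) (P-ind : IndependentCols A P)
    (p : Vector m) (p-ker : Ker A p) (p-positive : ∀ t → 0ℤ ℤ.< p t)
    {d} (outside-P : Enumeration (∁ P) (suc d)) where

    open Enumeration outside-P renaming (at to pivot)

    pivot∉P : ∀ l → pivot l ∉ P
    pivot∉P l = x∈∁p⇒x∉p (at-∈ l)

    adjoined : ∀ l → Σ (Vector m) λ v → Ker A v × SupportedOn (P ∪ ⁅ pivot (suc l) ⁆) v × v (pivot (suc l)) ≢ 0ℤ
    adjoined l = kernelVector-through A rank≤k (ℕP.≤-reflexive (sym ∣P∣≡k)) P-ind (pivot∉P (suc l))

    dir : Fin (suc d) → Vector m
    dir zero    = p
    dir (suc l) = proj₁ (adjoined l)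

    dir-ker : ∀ l → Ker A (dir l)
    dir-ker zero    = p-ker
    dir-ker (suc l) = proj₁ (proj₂ (adjoined l))

    dir-triangular : ∀ l {l′} → l′ ≢ suc l → dir (suc l) (pivot l′) ≡ 0ℤ
    dir-triangular l {l′} l′≢ = proj₁ (proj₂ (proj₂ (adjoined l))) (pivot l′)
      ([ pivot∉P l′ , l′≢ ∘ at-injective ∘ x∈⁅y⁆⇒x≡y (pivot (suc l)) ]′ ∘ x∈p∪q⁻ P ⁅ pivot (suc l) ⁆)

    dir-diagonal : ∀ l → dir (suc l) (pivot (suc l)) ≢ 0ℤ
    dir-diagonal l = proj₂ (proj₂ (proj₂ (adjoined l)))

    vanishing-on-pivots : ∀ {u : Vector m} → (∀ l → u (pivot l) ≡ 0ℤ) → SupportedOn P u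
    vanishing-on-pivots u-pivots j j∉P with at-surjective (x∉p⇒x∈∁p j∉P)
    ... | l , refl = u-pivots l

    module Unseparated {s t} (same : ∀ l → dir l s ≡ dir l t) (w : Vector m) (w-ker : Ker A w) (ws≢wt : w s ≢ w t) where

      Cleared : List (Fin d) → Vector m → Set
      Cleared ls u = Ker A u × u s ≢ u t × u (pivot zero) ≡ 0ℤ × (∀ {l} → l ∈ₗ ls → u (pivot (suc l)) ≡ 0ℤ)

      -- Clear the pivot coordinates one by one; the directions cannot tell s from t, so neither do the corrections.
      cleared : ∀ ls → Σ (Vector m) (Cleared ls)
      cleared [] = clear w p f₀ , Ker-lincomb A (p f₀) (- w f₀) w-ker p-ker
                 , clear-separates w p f₀ (0<⇒≢0 (p-positive f₀)) (same zero) ws≢wt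
                 , clear-at w p f₀ , λ ()
        where
        f₀ : Fin m
        f₀ = pivot zero
      cleared (l ∷ ls) with cleared ls
      ... | u , u-ker , us≢ut , u₀≡0 , u-ls≡0 =
        clear u v f , Ker-lincomb A (v f) (- u f) u-ker (dir-ker (suc l))
        , clear-separates u v f (dir-diagonal l) (same (suc l)) us≢ut
        , clear-zero u v f u₀≡0 (dir-triangular l λ ())
        , cleared-at
        where
        v : Vector m
        v = dir (suc l)
        f : Fin m
        f = pivot (suc l)
        cleared-at : ∀ {l′} → l′ ∈ₗ l ∷ ls → clear u v f (pivot (suc l′)) ≡ 0ℤ
        cleared-at (Any.here refl) = clear-at u v f
        cleared-at {l′} (Any.there l′∈ls) with l′ FinP.≟ l
        ... | yes refl = clear-at u v f
        ... | no l′≢l  = clear-zero u v f (u-ls≡0 l′∈ls) (dir-triangular l (l′≢l ∘ FinP.suc-injective))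

      impossible : ⊥
      impossible with cleared (allFin d)
      ... | u , u-ker , us≢ut , u₀≡0 , u-all≡0 = us≢ut (trans (u≡0 s) (sym (u≡0 t)))
        where
        u≡0 : ∀ j → u j ≡ 0ℤ
        u≡0 = P-ind u (vanishing-on-pivots λ { zero → u₀≡0 ; (suc l) → u-all≡0 (∈-allFin l) }) u-ker

    dir-separates : ∀ {s t} → s ≢ t → Σ (Fin (suc d)) λ l → dir l s ≢ dir l t
    dir-separates {s} {t} s≢t with FinP.any? (λ l → ¬? (dir l s ℤP.≟ dir l t))
    ... | yes separating = separating
    ... | no none with separatingKernelVector A abundant s≢t
    ...   | w , w-ker , ws≢wt = ⊥-elim (Unseparated.impossible same w w-ker ws≢wt)
      where
      same : ∀ l → dir l s ≡ dir l t
      same l = decidable-stable (dir l s ℤP.≟ dir l t) (none ∘ (l ,_))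

    frame : KernelFrame A d
    frame = record
      { pivot = pivot ; dir = dir ; dir-ker = dir-ker ; dir-positive = p-positive
      ; dir-triangular = dir-triangular ; dir-diagonal = dir-diagonal ; dir-separates = dir-separates }

  corank-nonzero : ∀ {r m} (A : Matrix r m) {P : Subset m} → IsPositive A → IsAbundant A → IndependentCols A P → ∣ ∁ P ∣ ≢ 0
  corank-nonzero {m = zero} A _ (k , ((Q , _ , ∣Q∣≡k , _) , _) , 0<k , _) _ _ =
    ℕP.<-irrefl refl (ℕP.<-≤-trans 0<k (subst (ℕ._≤ 0) ∣Q∣≡k (∣p∣≤n Q)))
  corank-nonzero {m = suc m} A {P} (p , p-ker , p-positive) _ P-ind ∣∁P∣≡0 =
    0<⇒≢0 (p-positive zero) (P-ind p p-supported p-ker zero)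
    where
    p-supported : SupportedOn P p
    p-supported j j∉P with Enumeration.at-surjective (enumeration (∁ P) ∣∁P∣≡0) (x∉p⇒x∈∁p j∉P)
    ... | () , _

  -- Dominant weights

  open ℕΣ using () renaming (sum to sumℕ)

  sumℕ-mono-≤ : ∀ {n} {f g : Fin n → ℕ} → (∀ l → f l ℕ.≤ g l) → sumℕ f ℕ.≤ sumℕ g
  sumℕ-mono-≤ {zero}  f≤g = z≤n
  sumℕ-mono-≤ {suc n} f≤g = ℕP.+-mono-≤ (f≤g zero) (sumℕ-mono-≤ (f≤g ∘ suc))

  ≤-sumℕ : ∀ {n} (f : Fin n → ℕ) l → f l ℕ.≤ sumℕ f
  ≤-sumℕ f zero    = ℕP.m≤m+n (f zero) _
  ≤-sumℕ f (suc l) = ℕP.≤-trans (≤-sumℕ (f ∘ suc) l) (ℕP.m≤n+m _ (f zero))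

  ∣sum∣≤sumℕ∣∣ : ∀ {n} (f : Fin n → ℤ) → ℤ.∣ sum f ∣ ℕ.≤ sumℕ (λ l → ℤ.∣ f l ∣)
  ∣sum∣≤sumℕ∣∣ {zero}  f = z≤n
  ∣sum∣≤sumℕ∣∣ {suc n} f =
    ℕP.≤-trans (ℤP.∣i+j∣≤∣i∣+∣j∣ (f zero) _) (ℕP.+-monoʳ-≤ ℤ.∣ f zero ∣ (∣sum∣≤sumℕ∣∣ (f ∘ suc)))

  -- A combination Σ aₗ yₗ with |aₗ| ≤ K and yₗ ∈ [weight l · T, (weight l + 1) · T) is dominated by its first
  -- nonzero term, because each weight exceeds K times the total mass of the later ones.
  weight : ℕ → (n : ℕ) → Fin n → ℕ
  weight K (suc n) zero    = suc (K ℕ.* sumℕ (λ l → suc (weight K n l)))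
  weight K (suc n) (suc l) = weight K n l

  mass : ℕ → ℕ → ℕ
  mass K n = sumℕ (λ l → suc (weight K n l))

  level : ∀ {n} (K T : ℕ) → (Fin n → ℕ) → Fin n → ℕ
  level {n} K T τ l = weight K n l ℕ.* T ℕ.+ τ l

  weighted : ∀ {n} (K T : ℕ) → (Fin n → ℕ) → (Fin n → ℤ) → ℤ
  weighted K T τ a = sum (λ l → a l * + level K T τ l)

  ∣weighted∣≤ : ∀ {n} K T (τ : Fin n → ℕ) (a : Fin n → ℤ) → (∀ l → ℤ.∣ a l ∣ ℕ.≤ K) → (∀ l → τ l ℕ.< T) →
    ℤ.∣ weighted K T τ a ∣ ℕ.≤ K ℕ.* (mass K n ℕ.* T)
  ∣weighted∣≤ {n} K T τ a a≤K τ<T = begin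
    ℤ.∣ weighted K T τ a ∣                                ≤⟨ ∣sum∣≤sumℕ∣∣ (λ l → a l * + level K T τ l) ⟩
    sumℕ (λ l → ℤ.∣ a l * + level K T τ l ∣)              ≤⟨ sumℕ-mono-≤ term≤ ⟩
    sumℕ (λ l → K ℕ.* (suc (weight K n l) ℕ.* T))         ≡⟨ sym (ℕΣ.*-distribˡ-sum K (λ l → suc (weight K n l) ℕ.* T)) ⟩
    K ℕ.* sumℕ (λ l → suc (weight K n l) ℕ.* T)           ≡⟨ cong (K ℕ.*_) (sym (ℕΣ.*-distribʳ-sum T (λ l → suc (weight K n l)))) ⟩
    K ℕ.* (mass K n ℕ.* T)                                ∎
    where
    open ℕP.≤-Reasoning
    term≤ : ∀ l → ℤ.∣ a l * + level K T τ l ∣ ℕ.≤ K ℕ.* (suc (weight K n l) ℕ.* T)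
    term≤ l rewrite ℤP.abs-* (a l) (+ level K T τ l) =
      ℕP.*-mono-≤ (a≤K l) (ℕP.≤-trans (ℕP.+-monoʳ-≤ (weight K n l ℕ.* T) (ℕP.<⇒≤ (τ<T l)))
                                      (ℕP.≤-reflexive (ℕP.+-comm (weight K n l ℕ.* T) T)))

  0<+ : ∀ U (v : ℤ) → ℤ.∣ v ∣ ℕ.< U → 0ℤ ℤ.< + U + v
  0<+ U (+ v)    ∣v∣<U = ℤ.+<+ (ℕP.<-≤-trans (ℕP.≤-<-trans z≤n ∣v∣<U) (ℕP.m≤m+n U v))
  0<+ U -[1+ v ] ∣v∣<U rewrite ℤP.⊖-≥ (ℕP.<⇒≤ ∣v∣<U) = ℤ.+<+ (ℕP.m<n⇒0<n∸m ∣v∣<U)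

  0<⇒≡+suc : ∀ {z} → 0ℤ ℤ.< z → Σ ℕ λ n → z ≡ + suc n
  0<⇒≡+suc {+ suc n} _ = n , refl
  0<⇒≡+suc {+ zero} (ℤ.+<+ ())

  weighted-positive : ∀ {n} K T (τ : Fin (suc n) → ℕ) (a : Fin (suc n) → ℤ) (c : ℤ) →
    (∀ l → ℤ.∣ a l ∣ ℕ.≤ K) → (∀ l → τ l ℕ.< T) → ℤ.∣ c ∣ ℕ.< T → 0ℤ ℤ.< a zero → 0ℤ ℤ.< c + weighted K T τ a
  weighted-positive {n} K T τ a c a≤K τ<T ∣c∣<T 0<a₀ with 0<⇒≡+suc 0<a₀
  ... | a₀′ , a₀≡ = subst (0ℤ ℤ.<_) (sym regroup) (0<+ lead (c + rest) ∣c+rest∣<lead)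
    where
    y₀ : ℕ
    y₀ = level K T τ zero
    lead : ℕ
    lead = suc a₀′ ℕ.* y₀
    rest : ℤ
    rest = weighted K T (τ ∘ suc) (a ∘ suc)
    swap : ∀ u c r → c + (u + r) ≡ u + (c + r)
    swap = solve-∀
    regroup : c + weighted K T τ a ≡ + lead + (c + rest)
    regroup = trans (cong (λ z → c + (z * + y₀ + rest)) a₀≡)
                    (trans (cong (λ z → c + (z + rest)) (sym (ℤP.pos-* (suc a₀′) y₀))) (swap (+ lead) c rest))
    ∣c+rest∣<lead : ℤ.∣ c + rest ∣ ℕ.< lead
    ∣c+rest∣<lead = begin-strict
      ℤ.∣ c + rest ∣                        ≤⟨ ℤP.∣i+j∣≤∣i∣+∣j∣ c rest ⟩
      ℤ.∣ c ∣ ℕ.+ ℤ.∣ rest ∣                 <⟨ ℕP.+-mono-<-≤ ∣c∣<T (∣weighted∣≤ K T (τ ∘ suc) (a ∘ suc) (a≤K ∘ suc) (τ<T ∘ suc)) ⟩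
      T ℕ.+ K ℕ.* (mass K n ℕ.* T)           ≡⟨ cong (T ℕ.+_) (sym (ℕP.*-assoc K (mass K n) T)) ⟩
      weight K (suc n) zero ℕ.* T            ≤⟨ ℕP.m≤m+n _ (τ zero) ⟩
      y₀                                     ≤⟨ ℕP.m≤m+n y₀ (a₀′ ℕ.* y₀) ⟩
      lead                                   ∎
      where open ℕP.≤-Reasoning

  weighted-neg : ∀ {n} K T (τ : Fin n → ℕ) (a : Fin n → ℤ) → weighted K T τ (λ l → - a l) ≡ - weighted K T τ a
  weighted-neg K T τ a = begin
    sum (λ l → (- a l) * + level K T τ l)          ≡⟨ ℤΣ.sum-cong-≗ (λ l → sym (negate (a l) (+ level K T τ l))) ⟩
    sum (λ l → -1ℤ * (a l * + level K T τ l))      ≡⟨ sym (ℤΣ.*-distribˡ-sum -1ℤ (λ l → a l * + level K T τ l)) ⟩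
    -1ℤ * weighted K T τ a                         ≡⟨ ℤP.-1*i≡-i (weighted K T τ a) ⟩
    - weighted K T τ a                             ∎
    where
    open ≡-Reasoning
    negate : ∀ x y → -1ℤ * (x * y) ≡ (- x) * y
    negate = solve-∀

  weighted-+ : ∀ {n} K T (τ : Fin n → ℕ) (a a′ : Fin n → ℤ) → weighted K T τ (λ l → a l + a′ l) ≡ weighted K T τ a + weighted K T τ a′
  weighted-+ K T τ a a′ =
    trans (ℤΣ.sum-cong-≗ (λ l → ℤP.*-distribʳ-+ (+ level K T τ l) (a l) (a′ l)))
          (ℤΣ.∑-distrib-+ (λ l → a l * + level K T τ l) (λ l → a′ l * + level K T τ l))

  weighted-nonzero : ∀ {n} K T (τ : Fin n → ℕ) (a : Fin n → ℤ) (c : ℤ) →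
    (∀ l → ℤ.∣ a l ∣ ℕ.≤ K) → (∀ l → τ l ℕ.< T) → ℤ.∣ c ∣ ℕ.< T → Σ (Fin n) (λ l → a l ≢ 0ℤ) →
    c + weighted K T τ a ≢ 0ℤ
  weighted-nonzero {suc n} K T τ a c a≤K τ<T ∣c∣<T (l , al≢0) with ℤP.<-cmp 0ℤ (a zero)
  ... | tri< 0<a₀ _ _ = 0<⇒≢0 (weighted-positive K T τ a c a≤K τ<T ∣c∣<T 0<a₀)
  ... | tri> _ _ a₀<0 = λ sum≡0 → 0<⇒≢0 negated-positive (trans negation (cong -_ sum≡0))
    where
    negated-positive : 0ℤ ℤ.< - c + weighted K T τ (λ l → - a l)
    negated-positive = weighted-positive K T τ (λ l → - a l) (- c)
      (λ l → subst (ℕ._≤ K) (sym (ℤP.∣-i∣≡∣i∣ (a l))) (a≤K l)) τ<T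
      (subst (ℕ._< T) (sym (ℤP.∣-i∣≡∣i∣ c)) ∣c∣<T) (ℤP.neg-mono-< a₀<0)
    negation : - c + weighted K T τ (λ l → - a l) ≡ - (c + weighted K T τ a)
    negation = trans (cong (λ z → - c + z) (weighted-neg K T τ a)) (sym (ℤP.neg-distrib-+ c _))
  ... | tri≈ _ 0≡a₀ _ = λ sum≡0 → weighted-nonzero K T (τ ∘ suc) (a ∘ suc) c (a≤K ∘ suc) (τ<T ∘ suc) ∣c∣<T tail-nonzero
                     (trans (sym drop-head) sum≡0)
    where
    tail-nonzero : Σ (Fin n) (λ l → a (suc l) ≢ 0ℤ)
    tail-nonzero = nonzero-after l al≢0
      where
      nonzero-after : ∀ l → a l ≢ 0ℤ → Σ (Fin n) (λ l → a (suc l) ≢ 0ℤ)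
      nonzero-after zero    a₀≢0 = ⊥-elim (a₀≢0 (sym 0≡a₀))
      nonzero-after (suc l) al≢0 = l , al≢0
    drop-head : c + weighted K T τ a ≡ c + weighted K T (τ ∘ suc) (a ∘ suc)
    drop-head = cong (λ z → c + z) (trans (cong (λ z → z * + level K T τ zero + weighted K T (τ ∘ suc) (a ∘ suc)) (sym 0≡a₀))
                                   (ℤP.+-identityˡ _))

  -- Counting

  ∈-box : ∀ m n (x : Vector m) → (∀ i → + 1 ℤ.≤ x i × x i ℤ.≤ + n) → Any.Any (x ≗_) (box m n)
  ∈-box zero    n x _       = Any.here λ ()
  ∈-box (suc m) n x x-range with x zero in x₀≡ | x-range zero
  ... | + zero    | ℤ.+≤+ () , _
  ... | -[1+ _ ]  | () , _
  ... | + suc x₀′ | _ , ℤ.+≤+ x₀′<n =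
    AnyP.concat⁺ (AnyP.map⁺ (Any.map extend (∈-box m n (x ∘ suc) (x-range ∘ suc))))
    where
    extend : ∀ {v} → x ∘ suc ≗ v → Any.Any (x ≗_) (map (λ a → (+ suc a) VF.∷ v) (upTo n))
    extend x∘suc≗v = AnyP.map⁺ (Any.map (λ { refl → λ { zero → x₀≡ ; (suc i) → x∘suc≗v i } }) (∈-upTo⁺ x₀′<n))

  ·-cong : ∀ {r m} (A : Matrix r m) {x y : Vector m} → x ≗ y → ∀ i → (A · x) i ≡ (A · y) i
  ·-cong A {x} {y} x≗y i = trans (sumFin≡sum (λ j → A i j * x j))
    (trans (ℤΣ.sum-cong-≗ (λ j → cong (A i j *_) (x≗y j))) (sym (sumFin≡sum (λ j → A i j * y j))))

  -- The counted list contains a copy of each gᵢ, and distinct i land at distinct positions.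
  countS0-≥ : ∀ {r m} (A : Matrix r m) (b : Vector r) n {N} (g : Fin N → Vector m) →
    (∀ {i j} → g i ≗ g j → i ≡ j) → (∀ i t → + 1 ℤ.≤ g i t × g i t ℤ.≤ + n) →
    (∀ i → IsSolution A b (g i)) → (∀ i → Distinct (g i)) → N ℕ.≤ countS0 A b n
  countS0-≥ {m = m} A b n {N} g g-injective g-range g-solution g-distinct = FinP.injective⇒≤ position-injective
    where
    solutions : List (Vector m)
    solutions = filter (λ x → isSolution? A b x) (box m n)
    counted : List (Vector m)
    counted = filter (λ x → distinct? x) solutions
    member : ∀ i → Any.Any (g i ≗_) counted
    member i = SetoidMembershipP.∈-filter⁺ (Fin m →-setoid ℤ) (λ x → distinct? x) distinct-resp
                 (SetoidMembershipP.∈-filter⁺ (Fin m →-setoid ℤ) (λ x → isSolution? A b x) solution-resp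
                   (∈-box m n (g i) (g-range i)) (g-solution i))
                 (g-distinct i)
      where
      solution-resp : ∀ {x y} → x ≗ y → IsSolution A b x → IsSolution A b y
      solution-resp x≗y x-sol t = trans (sym (·-cong A x≗y t)) (x-sol t)
      distinct-resp : ∀ {x y} → x ≗ y → Distinct x → Distinct y
      distinct-resp x≗y x-dis s t s≢t ys≡yt = x-dis s t s≢t (trans (x≗y s) (trans ys≡yt (sym (x≗y t))))
    position : Fin N → Fin (length counted)
    position i = Any.index (member i)
    position-injective : ∀ {i j} → position i ≡ position j → i ≡ j
    position-injective {i} {j} same = g-injective λ t →
      trans (AnyP.lookup-index (member i) t) (trans (cong (λ z → lookup counted z t) same) (sym (AnyP.lookup-index (member j) t)))

  -- Lattice points along the frame

  funToFin-cong : ∀ {m n} {f g : Fin m → Fin n} → f ≗ g → funToFin f ≡ funToFin g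
  funToFin-cong {zero}  _   = refl
  funToFin-cong {suc m} f≗g = cong₂ combine (f≗g zero) (funToFin-cong (f≗g ∘ suc))

  finToFun-injective : ∀ {T D} {i j : Fin (T ^ D)} → finToFun i ≗ finToFun j → i ≡ j
  finToFun-injective {T} {D} {i} {j} same =
    trans (sym (FinP.funToFin-finToFin {D} {T} i))
          (trans (funToFin-cong {D} {T} same) (FinP.funToFin-finToFin {D} {T} j))

  +*-cancel : ∀ x a {Y Y′} → a ≢ 0ℤ → x + a * + Y ≡ x + a * + Y′ → Y ≡ Y′
  +*-cancel x a a≢0 eq = ℤP.+-injective (ℤP.*-cancelˡ-≡ a _ _ {{ℤ.≢-nonZero a≢0}} (∙-cancelˡ x _ _ eq))

  *-^ : ∀ a b n → (a ℕ.* b) ^ n ≡ a ^ n ℕ.* b ^ n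
  *-^ a b zero    = refl
  *-^ a b (suc n) = trans (cong (a ℕ.* b ℕ.*_) (*-^ a b n)) (interchange a b (a ^ n) (b ^ n))
    where
    interchange : ∀ a b x y → a ℕ.* b ℕ.* (x ℕ.* y) ≡ a ℕ.* x ℕ.* (b ℕ.* y)
    interchange = ℕSolver.solve-∀

  quotient-bounds : ∀ E .{{_ : ℕ.NonZero E}} T₀ n → 1 ℕ.≤ T₀ → E ℕ.* T₀ ℕ.≤ n →
    T₀ ℕ.≤ n DM./ E × E ℕ.* (n DM./ E) ℕ.≤ n × n ℕ.≤ 2 ℕ.* E ℕ.* (n DM./ E)
  quotient-bounds E T₀ n 1≤T₀ ET₀≤n = T₀≤T , ET≤n , n≤2ET
    where
    T : ℕ
    T = n DM./ E
    T₀≤T : T₀ ℕ.≤ T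
    T₀≤T = subst (ℕ._≤ T) (DM.m*n/n≡m T₀ E) (DM./-monoˡ-≤ E (subst (ℕ._≤ n) (ℕP.*-comm E T₀) ET₀≤n))
    ET≤n : E ℕ.* T ℕ.≤ n
    ET≤n = subst (ℕ._≤ n) (ℕP.*-comm T E) (DM.m/n*n≤m n E)
    n≤2ET : n ℕ.≤ 2 ℕ.* E ℕ.* T
    n≤2ET = begin
      n                        ≡⟨ DM.m≡m%n+[m/n]*n n E ⟩
      n DM.% E ℕ.+ T ℕ.* E     ≤⟨ ℕP.+-monoˡ-≤ (T ℕ.* E) (ℕP.<⇒≤ (DM.m%n<n n E)) ⟩
      E ℕ.+ T ℕ.* E            ≤⟨ ℕP.+-monoˡ-≤ (T ℕ.* E) (ℕP.m≤m*n E T {{ℕ.>-nonZero (ℕP.≤-trans 1≤T₀ T₀≤T)}}) ⟩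
      E ℕ.* T ℕ.+ T ℕ.* E      ≡⟨ double E T ⟩
      2 ℕ.* E ℕ.* T            ∎
      where
      open ℕP.≤-Reasoning
      double : ∀ E T → E ℕ.* T ℕ.+ T ℕ.* E ≡ 2 ℕ.* E ℕ.* T
      double = ℕSolver.solve-∀

  GrowsAtLeast : (ℕ → ℕ) → ℕ → Set
  GrowsAtLeast f e = Σ ℕ λ C → Σ ℕ λ n₀ → ∀ n → n ℕ.≥ n₀ → n ^ e ℕ.≤ f n ℕ.* suc C

  grows-from-boxes : ∀ {f : ℕ → ℕ} {D} E .{{_ : ℕ.NonZero E}} T₀ → 1 ℕ.≤ T₀ →
    (∀ {T} n → T₀ ℕ.≤ T → E ℕ.* T ℕ.≤ n → T ^ D ℕ.≤ f n) → GrowsAtLeast f D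
  grows-from-boxes {f} {D} E T₀ 1≤T₀ boxes = ℕ.pred C , E ℕ.* T₀ , bound
    where
    C : ℕ
    C = (2 ℕ.* E) ^ D
    bound : ∀ n → n ℕ.≥ E ℕ.* T₀ → n ^ D ℕ.≤ f n ℕ.* suc (ℕ.pred C)
    bound n ET₀≤n with quotient-bounds E T₀ n 1≤T₀ ET₀≤n
    ... | T₀≤T , ET≤n , n≤2ET = begin
      n ^ D                          ≤⟨ ℕP.^-monoˡ-≤ D n≤2ET ⟩
      (2 ℕ.* E ℕ.* T) ^ D            ≡⟨ *-^ (2 ℕ.* E) T D ⟩
      C ℕ.* T ^ D                    ≤⟨ ℕP.*-monoʳ-≤ C (boxes n T₀≤T ET≤n) ⟩
      C ℕ.* f n                      ≡⟨ ℕP.*-comm C (f n) ⟩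
      f n ℕ.* C                      ≡⟨ cong (f n ℕ.*_) (sym (ℕP.suc-pred C {{ℕP.m^n≢0 (2 ℕ.* E) D {{ℕP.m*n≢0 2 E}}}})) ⟩
      f n ℕ.* suc (ℕ.pred C)         ∎
      where
      open ℕP.≤-Reasoning
      T : ℕ
      T = n DM./ E

  in-range : ∀ {z n} → 0ℤ ℤ.< z → ℤ.∣ z ∣ ℕ.≤ n → + 1 ℤ.≤ z × z ℤ.≤ + n
  in-range {+ suc _} _ ∣z∣≤n = ℤ.+≤+ (s≤s z≤n) , ℤ.+≤+ ∣z∣≤n
  in-range {+ zero} (ℤ.+<+ ()) _

  module Lattice {r m} {A : Matrix r m} {b : Vector r} {d} (F : KernelFrame A d)
                 (x₀ : Vector m) (x₀-solution : IsSolution A b x₀) where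

    open KernelFrame F

    -- K bounds the coefficients dir l t and dir l s − dir l t, Tmin exceeds |x₀ t| and |x₀ s − x₀ t|,
    -- and E·T bounds the entries of every point at scale T.
    D K N₀ Tmin E : ℕ
    D    = sumℕ (λ l → sumℕ (λ t → ℤ.∣ dir l t ∣))
    K    = D ℕ.+ D
    N₀   = sumℕ (λ t → ℤ.∣ x₀ t ∣)
    Tmin = suc (N₀ ℕ.+ N₀)
    E    = suc (N₀ ℕ.+ K ℕ.* mass K (suc d))

    ∣dir∣≤D : ∀ l t → ℤ.∣ dir l t ∣ ℕ.≤ D
    ∣dir∣≤D l t = ℕP.≤-trans (≤-sumℕ (λ t → ℤ.∣ dir l t ∣) t) (≤-sumℕ (λ l → sumℕ (λ t → ℤ.∣ dir l t ∣)) l)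

    ∣dir∣≤K : ∀ l t → ℤ.∣ dir l t ∣ ℕ.≤ K
    ∣dir∣≤K l t = ℕP.≤-trans (∣dir∣≤D l t) (ℕP.m≤m+n D D)

    ∣dir-dir∣≤K : ∀ s t l → ℤ.∣ dir l s - dir l t ∣ ℕ.≤ K
    ∣dir-dir∣≤K s t l = ℕP.≤-trans (ℤP.∣i-j∣≤∣i∣+∣j∣ (dir l s) (dir l t)) (ℕP.+-mono-≤ (∣dir∣≤D l s) (∣dir∣≤D l t))

    ∣x₀∣≤N₀ : ∀ t → ℤ.∣ x₀ t ∣ ℕ.≤ N₀
    ∣x₀∣≤N₀ = ≤-sumℕ (λ t → ℤ.∣ x₀ t ∣)

    point : ℕ → (Fin (suc d) → ℕ) → Vector m
    point T τ t = x₀ t + weighted K T τ (λ l → dir l t)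

    point-solution : ∀ T τ → IsSolution A b (point T τ)
    point-solution T τ i = begin
      A i ⊙ point T τ
        ≡⟨ ⊙-+ʳ (A i) x₀ (λ t → weighted K T τ (λ l → dir l t)) ⟩
      A i ⊙ x₀ + A i ⊙ (λ t → sum (λ l → dir l t * y l))
        ≡⟨ cong₂ _+_ (x₀-solution i) (trans (⊙-sum (A i) dir y) (sum-zero λ l → cong (_* y l) (dir-ker l i))) ⟩
      b i + 0ℤ
        ≡⟨ ℤP.+-identityʳ (b i) ⟩
      b i ∎
      where
      open ≡-Reasoning
      y : Fin (suc d) → ℤ
      y l = + level K T τ l

    weighted-at-pivot₀ : ∀ T τ → weighted K T τ (λ l → dir l (pivot zero)) ≡ dir zero (pivot zero) * + level K T τ zero
    weighted-at-pivot₀ T τ = sum-single (λ l → dir l (pivot zero) * + level K T τ l) zero vanish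
      where
      vanish : ∀ l → l ≢ zero → dir l (pivot zero) * + level K T τ l ≡ 0ℤ
      vanish zero    l≢0 = ⊥-elim (l≢0 refl)
      vanish (suc l) _   = trans (cong (_* + level K T τ (suc l)) (dir-triangular l λ ())) (ℤP.*-zeroˡ (+ level K T τ (suc l)))

    weighted-at-pivot : ∀ T τ l → let f = pivot (suc l) in
      weighted K T τ (λ l′ → dir l′ f) ≡ dir zero f * + level K T τ zero + dir (suc l) f * + level K T τ (suc l)
    weighted-at-pivot T τ l = cong (λ z → dir zero f * + level K T τ zero + z) (sum-single (λ l′ → dir (suc l′) f * + level K T τ (suc l′)) l vanish)
      where
      f : Fin m
      f = pivot (suc l)
      vanish : ∀ l′ → l′ ≢ l → dir (suc l′) f * + level K T τ (suc l′) ≡ 0ℤ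
      vanish l′ l′≢l = trans (cong (_* + level K T τ (suc l′)) (dir-triangular l′ (l′≢l ∘ sym ∘ FinP.suc-injective)))
                             (ℤP.*-zeroˡ (+ level K T τ (suc l′)))

    -- The value at pivot 0 determines the level of p, and then the value at pivot (suc l) that of direction suc l.
    point-injective : ∀ T {τ τ′} → point T τ ≗ point T τ′ → ∀ l → τ l ≡ τ′ l
    point-injective T {τ} {τ′} same l = ℕP.+-cancelˡ-≡ (weight K (suc d) l ℕ.* T) _ _ (same-level l)
      where
      f₀ : Fin m
      f₀ = pivot zero
      same-level : ∀ l → level K T τ l ≡ level K T τ′ l
      same-level zero = +*-cancel (x₀ f₀) (dir zero f₀) (0<⇒≢0 (dir-positive f₀)) (begin
        x₀ f₀ + dir zero f₀ * + level K T τ zero    ≡⟨ cong (λ z → x₀ f₀ + z) (sym (weighted-at-pivot₀ T τ)) ⟩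
        point T τ f₀                               ≡⟨ same f₀ ⟩
        point T τ′ f₀                              ≡⟨ cong (λ z → x₀ f₀ + z) (weighted-at-pivot₀ T τ′) ⟩
        x₀ f₀ + dir zero f₀ * + level K T τ′ zero  ∎)
        where open ≡-Reasoning
      same-level (suc l) = +*-cancel (x₀ f + dir zero f * + level K T τ zero) (dir (suc l) f) (dir-diagonal l) (begin
        x₀ f + dir zero f * + level K T τ zero + dir (suc l) f * + level K T τ (suc l)
          ≡⟨ trans (ℤP.+-assoc (x₀ f) _ _) (cong (λ z → x₀ f + z) (sym (weighted-at-pivot T τ l))) ⟩
        point T τ f
          ≡⟨ same f ⟩
        point T τ′ f
          ≡⟨ trans (cong (λ z → x₀ f + z) (weighted-at-pivot T τ′ l)) (sym (ℤP.+-assoc (x₀ f) _ _)) ⟩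
        x₀ f + dir zero f * + level K T τ′ zero + dir (suc l) f * + level K T τ′ (suc l)
          ≡⟨ cong (λ z → x₀ f + dir zero f * + z + dir (suc l) f * + level K T τ′ (suc l)) (sym (same-level zero)) ⟩
        x₀ f + dir zero f * + level K T τ zero + dir (suc l) f * + level K T τ′ (suc l) ∎)
        where
        open ≡-Reasoning
        f : Fin m
        f = pivot (suc l)

    module _ {T} (Tmin≤T : Tmin ℕ.≤ T) {τ : Fin (suc d) → ℕ} (τ<T : ∀ l → τ l ℕ.< T) where

      ∣x₀∣<T : ∀ t → ℤ.∣ x₀ t ∣ ℕ.< T
      ∣x₀∣<T t = ℕP.<-≤-trans (s≤s (ℕP.≤-trans (∣x₀∣≤N₀ t) (ℕP.m≤m+n N₀ N₀))) Tmin≤T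

      ∣x₀-x₀∣<T : ∀ s t → ℤ.∣ x₀ s - x₀ t ∣ ℕ.< T
      ∣x₀-x₀∣<T s t = ℕP.<-≤-trans (s≤s (ℕP.≤-trans (ℤP.∣i-j∣≤∣i∣+∣j∣ (x₀ s) (x₀ t)) (ℕP.+-mono-≤ (∣x₀∣≤N₀ s) (∣x₀∣≤N₀ t)))) Tmin≤T

      point-positive : ∀ t → 0ℤ ℤ.< point T τ t
      point-positive t = weighted-positive K T τ (λ l → dir l t) (x₀ t) (λ l → ∣dir∣≤K l t) τ<T (∣x₀∣<T t) (dir-positive t)

      point-distinct : Distinct (point T τ)
      point-distinct s t s≢t same with dir-separates s≢t
      ... | l , dir-differs = weighted-nonzero K T τ (λ l → dir l s - dir l t) (x₀ s - x₀ t) (∣dir-dir∣≤K s t) τ<T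
                                (∣x₀-x₀∣<T s t) (l , dir-differs ∘ ℤP.i-j≡0⇒i≡j (dir l s) (dir l t)) difference≡0
        where
        ws : ℤ
        ws = weighted K T τ (λ l → dir l s)
        wt : ℤ
        wt = weighted K T τ (λ l → dir l t)
        regroup : ∀ a b c d → a - b + (c - d) ≡ (a + c) - (b + d)
        regroup = solve-∀
        difference≡0 : x₀ s - x₀ t + weighted K T τ (λ l → dir l s - dir l t) ≡ 0ℤ
        difference≡0 = begin
          x₀ s - x₀ t + weighted K T τ (λ l → dir l s - dir l t)
            ≡⟨ cong (λ z → x₀ s - x₀ t + z) (trans (weighted-+ K T τ (λ l → dir l s) (λ l → - dir l t))
                                                    (cong (λ z → ws + z) (weighted-neg K T τ (λ l → dir l t)))) ⟩
          x₀ s - x₀ t + (ws - wt)     ≡⟨ regroup (x₀ s) (x₀ t) ws wt ⟩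
          point T τ s - point T τ t   ≡⟨ cong (_- point T τ t) same ⟩
          point T τ t - point T τ t   ≡⟨ ℤP.+-inverseʳ (point T τ t) ⟩
          0ℤ                          ∎
          where open ≡-Reasoning

      point-bounded : ∀ t → ℤ.∣ point T τ t ∣ ℕ.≤ E ℕ.* T
      point-bounded t = begin
        ℤ.∣ point T τ t ∣                                ≤⟨ ℤP.∣i+j∣≤∣i∣+∣j∣ (x₀ t) _ ⟩
        ℤ.∣ x₀ t ∣ ℕ.+ ℤ.∣ weighted K T τ (λ l → dir l t) ∣
          ≤⟨ ℕP.+-mono-≤ (∣x₀∣≤N₀ t) (∣weighted∣≤ K T τ (λ l → dir l t) (λ l → ∣dir∣≤K l t) τ<T) ⟩
        N₀ ℕ.+ K ℕ.* (mass K (suc d) ℕ.* T)              ≤⟨ ℕP.+-monoˡ-≤ _ (ℕP.m≤m*n N₀ T {{ℕ.>-nonZero (ℕP.<-≤-trans (s≤s z≤n) Tmin≤T)}}) ⟩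
        N₀ ℕ.* T ℕ.+ K ℕ.* (mass K (suc d) ℕ.* T)         ≤⟨ ℕP.m≤n+m _ T ⟩
        T ℕ.+ (N₀ ℕ.* T ℕ.+ K ℕ.* (mass K (suc d) ℕ.* T)) ≡⟨ cong (T ℕ.+_) regroup ⟩
        E ℕ.* T                                          ∎
        where
        open ℕP.≤-Reasoning
        regroup : N₀ ℕ.* T ℕ.+ K ℕ.* (mass K (suc d) ℕ.* T) ≡ (N₀ ℕ.+ K ℕ.* mass K (suc d)) ℕ.* T
        regroup = trans (cong (N₀ ℕ.* T ℕ.+_) (sym (ℕP.*-assoc K _ T))) (sym (ℕP.*-distribʳ-+ T N₀ _))

    count-≥ : ∀ {T} n → Tmin ℕ.≤ T → E ℕ.* T ℕ.≤ n → T ^ suc d ℕ.≤ countS0 A b n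
    count-≥ {T} n Tmin≤T ET≤n =
      countS0-≥ A b n g g-injective g-range (λ i → point-solution T (τ i)) (λ i → point-distinct Tmin≤T (τ<T i))
      where
      τ : Fin (T ^ suc d) → Fin (suc d) → ℕ
      τ i l = toℕ (finToFun i l)
      τ<T : ∀ i l → τ i l ℕ.< T
      τ<T i l = FinP.toℕ<n (finToFun i l)
      g : Fin (T ^ suc d) → Vector m
      g i = point T (τ i)
      g-injective : ∀ {i j} → g i ≗ g j → i ≡ j
      g-injective same = finToFun-injective (FinP.toℕ-injective ∘ point-injective T same)
      g-range : ∀ i t → + 1 ℤ.≤ g i t × g i t ℤ.≤ + n
      g-range i t = in-range (point-positive Tmin≤T (τ<T i) t) (ℕP.≤-trans (point-bounded Tmin≤T (τ<T i) t) ET≤n)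

    polynomial-lower-bound : GrowsAtLeast (countS0 A b) (suc d)
    polynomial-lower-bound = grows-from-boxes {D = suc d} E Tmin (s≤s z≤n) count-≥

open Construction
  using (GrowsAtLeast; KernelFrame; HasRank⇒RankAtMost; enumeration; corank-nonzero; module FrameConstruction; module Lattice)
open import Data.Nat as ℕ using (ℕ; _∸_; _^_; _≥_; suc; s≤s; z≤n)
open import Data.Integer as ℤ using (ℤ; +_)
open import Data.Rational using (ℚ; 0ℚ; _<_; _≤_; _*_; _/_)
open import Data.Product using (Σ; _×_; _,_)
import Data.Nat.Properties as ℕP
import Data.Integer.Properties as ℤP
import Data.Rational.Properties as ℚP
open import Data.Rational.Unnormalised using (mkℚᵘ; *≤*; *<*)
import Data.Rational.Unnormalised.Properties as ℚᵘP
open import Data.Fin.Subset using (∁; ∣_∣)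
open import Data.Fin.Subset.Properties using (∣∁p∣≡n∸∣p∣)
open import Relation.Binary.PropositionalEquality

scaled-≤ : ∀ c N C → N ℕ.≤ C ℕ.* suc c → (+ 1 / suc c) * (+ N / 1) ≤ + C / 1
scaled-≤ c N C N≤C[c+1] = ℚP.toℚᵘ-cancel-≤
  (ℚᵘP.≤-respʳ-≃ (ℚᵘP.≃-sym (ℚP.toℚᵘ-fromℚᵘ (mkℚᵘ (+ C) 0)))
    (ℚᵘP.≤-respˡ-≃ (ℚᵘP.≃-sym (ℚᵘP.≃-trans (ℚP.toℚᵘ-homo-* (+ 1 / suc c) (+ N / 1))
                                           (ℚᵘP.*-cong (ℚP.toℚᵘ-fromℚᵘ (mkℚᵘ (+ 1) c)) (ℚP.toℚᵘ-fromℚᵘ (mkℚᵘ (+ N) 0)))))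
      (*≤* (subst₂ ℤ._≤_ (sym (trans (ℤP.*-identityʳ _) (ℤP.*-identityˡ _))) (ℤP.pos-* C (suc c ℕ.* 1))
                         (ℤ.+≤+ (subst (λ x → N ℕ.≤ C ℕ.* x) (sym (ℕP.*-identityʳ (suc c))) N≤C[c+1]))))))

1/suc-positive : ∀ c → 0ℚ < + 1 / suc c
1/suc-positive c = ℚP.toℚᵘ-cancel-< (ℚᵘP.<-respʳ-≃ (ℚᵘP.≃-sym (ℚP.toℚᵘ-fromℚᵘ (mkℚᵘ (+ 1) c))) (*<* (ℤ.+<+ (s≤s z≤n))))

GrowsAtLeast⇒ℚ-bound : ∀ (f : ℕ → ℕ) e → GrowsAtLeast f e →
  Σ ℚ λ c₀ → 0ℚ < c₀ × Σ ℕ λ n₀ → (n : ℕ) → n ≥ n₀ → c₀ * ((+ (n ^ e)) / 1) ≤ (+ f n) / 1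
GrowsAtLeast⇒ℚ-bound f e (c , n₀ , bound) = + 1 / suc c , 1/suc-positive c , n₀ , λ n n≥n₀ → scaled-≤ c (n ^ e) (f n) (bound n n≥n₀)

lemma4p1 : (r m : ℕ) (A : Matrix r m) (b : Vector r) (k : ℕ) →
    IsPositive A → IsAbundant A → HasRank A k → SolvableIn A b →
    Σ ℚ λ c₀ → 0ℚ < c₀ × Σ ℕ λ n₀ → (n : ℕ) → n ≥ n₀ →
      c₀ * ((+ (n ^ (m ∸ k))) / 1) ≤ (+ countS0 A b n) / 1
lemma4p1 r m A b k positive@(p , p-ker , p-positive) abundant rank-k@((P , _ , ∣P∣≡k , P-ind) , _) (x₀ , x₀-solution) =
  GrowsAtLeast⇒ℚ-bound (countS0 A b) (m ∸ k) (subst (GrowsAtLeast (countS0 A b)) corank grows)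
  where
  d : ℕ
  d = ℕ.pred ∣ ∁ P ∣
  ∣∁P∣≡1+d : ∣ ∁ P ∣ ≡ suc d
  ∣∁P∣≡1+d = sym (ℕP.suc-pred ∣ ∁ P ∣ {{ℕ.≢-nonZero (corank-nonzero A positive abundant P-ind)}})
  frame : KernelFrame A d
  frame = FrameConstruction.frame A abundant (HasRank⇒RankAtMost A rank-k) ∣P∣≡k P-ind p p-ker p-positive
                                  (enumeration (∁ P) ∣∁P∣≡1+d)
  grows : GrowsAtLeast (countS0 A b) (suc d)
  grows = Lattice.polynomial-lower-bound frame x₀ x₀-solution
  corank : suc d ≡ m ∸ k
  corank = trans (sym ∣∁P∣≡1+d) (trans (∣∁p∣≡n∸∣p∣ P) (cong (m ∸_) ∣P∣≡k))
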